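{- Let $s,k\geq 2$ be integers with $s\geq 2k$. Let $\mathcal{F}$ be an $s$-super-homogeneous $k$-partite $k$-graph on $[n]$ with fixed $k$-partition $(X_1,\dots,X_k)$. Then: (1) for each $J\subsetneq[k]$ with $J\notin\mathrm{MI}(\mathcal{F})$ and each $F\in\mathcal{F}$, there is no $F'\in\mathcal{F}$ with $F\cap F'=F_J$; (2) for all $J,J'\in\mathrm{MI}(\mathcal{F})$, $J\cap J'\in\mathrm{MI}(\mathcal{F})$; (3) if $\mathrm{MI}(\mathcal{F})$ has rank $m$, then $|\mathcal{F}|\leq\binom{n}{m}$.
   Context: A $k$-graph is $k$-partite with $k$-partition $(X_1,\dots,X_k)$ if every edge has exactly one vertex in each $X_i$. For $J\subseteq[k]$ and an edge $F$, $F_J=F\cap\bigcup_{i\in J}X_i$; the pattern of a subset $D$ of an edge is $\pi(D)=\{i: D\cap X_i\neq\emptyset\}$; $\mathrm{MI}(\mathcal{F})=\{\pi(E\cap F):E,F\in\mathcal{F},E\neq F\}$. The link $\mathcal{L}_{\mathcal{F}}(D)=\{F\setminus D: F\in\mathcal{F}, D\subseteq F\}$ and $d_{\mathcal{F}}(D)=|\mathcal{L}_{\mathcal{F}}(D)|$. A nonempty hypergraph $\mathcal{L}$ is $s$-diverse if every vertex lies in fewer than $|\mathcal{L}|/s$ of its edges; $D$ is $s$-strong in $\mathcal{F}$ if $\mathcal{L}_{\mathcal{F}}(D)$ is $s$-diverse. The $k$-partite $k$-graph $\mathcal{F}$ on $[n]$ with this partition is $s$-super-homogeneous if for every $J\in\mathrm{MI}(\mathcal{F})$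 and $F\in\mathcal{F}$, $F_J$ is $s$-strong and $d_{\mathcal{F}}(F_J)\geq\max\{s,\frac{1}{2k}\frac{|\mathcal{F}|}{n^{|J|}}\}$. For a family $\mathcal{J}$ of proper subsets of $[k]$, its rank is $r(\mathcal{J})=\min\{|D|: D\subseteq[k],\ D\not\subseteq J \text{ for all } J\in\mathcal{J}\}$. -}

module Defs where

open import Data.Bool using (Bool; true; false)
open import Data.Nat using (ℕ; zero; suc; _+_; _*_; _^_; _≤_; _<_)
open import Data.Fin using (Fin; _≟_)
open import Data.Fin.Subset using (Subset; _∩_; _─_; _⊆_; ⊤; ∣_∣; _∈_; _∉_; inside)
open import Data.Fin.Subset.Properties using (nonempty?; _⊆?_; _∈?_)
open import Data.Vec using (tabulate; lookup)
open import Data.List using (List; length; filter; map)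
open import Data.List.Relation.Unary.Unique.Propositional using (Unique)
import Data.List.Membership.Propositional as LM
open import Data.Product using (Σ; ∃; _×_; _,_)
open import Relation.Nullary using (¬_; Dec; does)
open import Relation.Binary.PropositionalEquality using (_≡_; _≢_)

-- A k-partition of [n] = Fin n is given by a colouring col : Fin n → Fin k;
-- X col i is the part X_i = { v | col v = i }.
X : ∀ {n k} → (Fin n → Fin k) → Fin k → Subset n
X col i = tabulate (λ v → does (col v ≟ i))

XJ : ∀ {n k} → (Fin n → Fin k) → Subset k → Subset n
XJ col J = tabulate (λ v → lookup J (col v))

-- F_J = F ∩ ⋃_{i ∈ J} X_i
restrict : ∀ {n k} → (Fin n → Fin k) → Subset n → Subset k → Subset n
restrict col F J = F ∩ XJ col J

pattern' : ∀ {n k} → (Fin n → Fin k) → Subset n → Subset k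
pattern' col D = tabulate (λ i → does (nonempty? (D ∩ X col i)))

Hypergraph : ℕ → Set
Hypergraph n = List (Subset n)

IsKPartite : ∀ {n k} → (Fin n → Fin k) → Hypergraph n → Set
IsKPartite {k = k} col ℱ =
  Unique ℱ × (∀ F → F LM.∈ ℱ → ∀ (i : Fin k) → ∣ F ∩ X col i ∣ ≡ 1)

InMI : ∀ {n k} → (Fin n → Fin k) → Hypergraph n → Subset k → Set
InMI col ℱ J =
  ∃ λ E → ∃ λ F → E LM.∈ ℱ × F LM.∈ ℱ × E ≢ F × pattern' col (E ∩ F) ≡ J

link : ∀ {n} → Hypergraph n → Subset n → Hypergraph n
link ℱ D = map (λ F → F ─ D) (filter (D ⊆?_) ℱ)

deg : ∀ {n} → Hypergraph n → Subset n → ℕ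
deg ℱ D = length (link ℱ D)

vdeg : ∀ {n} → Hypergraph n → Fin n → ℕ
vdeg ℒ v = length (filter (v ∈?_) ℒ)

-- ℒ is s-diverse: nonempty, and every vertex lies in fewer than |ℒ|/s edges
-- (written as s · deg(v) < |ℒ|, equivalent for s ≥ 1).
Diverse : ∀ {n} → ℕ → Hypergraph n → Set
Diverse {n} s ℒ = 0 < length ℒ × (∀ (v : Fin n) → s * vdeg ℒ v < length ℒ)

Strong : ∀ {n} → ℕ → Hypergraph n → Subset n → Set
Strong s ℱ D = Diverse s (link ℱ D)

-- s-super-homogeneous: for all J ∈ MI(ℱ), F ∈ ℱ: F_J is s-strong and
-- d(F_J) ≥ max{ s , |ℱ| / (2k n^{|J|}) }  (the latter as |ℱ| ≤ 2k n^{|J|} d(F_J)).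
SuperHomogeneous : ∀ {n k} → ℕ → (Fin n → Fin k) → Hypergraph n → Set
SuperHomogeneous {n} {k} s col ℱ =
  ∀ J → InMI col ℱ J → ∀ F → F LM.∈ ℱ →
    Strong s ℱ (restrict col F J)
    × s ≤ deg ℱ (restrict col F J)
    × length ℱ ≤ 2 * k * n ^ ∣ J ∣ * deg ℱ (restrict col F J)

NotCovered : ∀ {n k} → (Fin n → Fin k) → Hypergraph n → Subset k → Set
NotCovered col ℱ D = ∀ J → InMI col ℱ J → ¬ (D ⊆ J)

-- r(MI(ℱ)) = m : m is the minimum size of such a D
RankMI : ∀ {n k} → (Fin n → Fin k) → Hypergraph n → ℕ → Set
RankMI col ℱ m =
  (∃ λ D → NotCovered col ℱ D × ∣ D ∣ ≡ m)
  × (∀ D → NotCovered col ℱ D → m ≤ ∣ D ∣)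

-- Every edge has exactly one vertex of each colour, so a subset of an edge F is determined by
-- the colours it uses and F_D has exactly |D| elements.  Hence F ∩ F′ = F_J with F′ ≠ F
-- witnesses J ∈ MI(ℱ) (part 1), and F ↦ F_D is injective on ℱ as soon as D lies in no member
-- of MI(ℱ), which gives |ℱ| ≤ (n choose |D|) (part 3).  For part 2, double counting shows that
-- no k ≤ s vertices can meet every edge of an s-diverse hypergraph, so the link of E_J has an
-- edge missing the k vertices of F; it extends E_J to an edge E′ with F ∩ E′ ⊆ E_J.  Doing this
-- once from F_J and then from E_{J′} yields an edge meeting F in exactly F_{J ∩ J′}.
module Submission where

open import Defs
open import Data.Bool using (Bool; true; false; _∧_)
import Data.Bool as Bool
open import Data.Nat using (ℕ; zero; suc; _+_; _*_; _≤_; _<_; z≤n; s≤s)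
open import Data.Nat.Properties
  using (+-0-commutativeMonoid; +-*-semiring; +-mono-≤; +-monoʳ-≤; *-monoʳ-≤; *-monoˡ-≤; *-identityʳ;
         +-cancelʳ-≤; +-suc; suc-injective; ≤-trans; ≤-reflexive; ≤⇒≯; m≤m+n; m≤n+m; n≤0⇒n≡0;
         ≰⇒>; <⇒≱; module ≤-Reasoning)
open import Data.Nat.Combinatorics using (_C_; nCk+nC[k+1]≡[n+1]C[k+1])
open import Data.Fin using (Fin; _≟_; punchIn) renaming (zero to fzero; suc to fsuc)
open import Data.Fin.Properties using (punchInᵢ≢i; any?; ¬Fin0)
open import Data.Fin.Subset
  using (Subset; _∈_; _∉_; _∩_; _─_; _-_; _⊆_; ⊤; Nonempty; Empty; ∣_∣; inside; outside)
open import Data.Fin.Subset.Properties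
  using (_∈?_; _⊆?_; nonempty?; x∈p∩q⁺; x∈p∩q⁻; x∈p∧x∉q⇒x∈p─q; ⊆-antisym; ∈⊤; ∩-comm;
         ∣⁅x⁆∣≡1; x∈⁅y⁆⇒x≡y; p⊆q⇒∣p∣≤∣q∣; x∈p⇒∣p-x∣<∣p∣; x∈p∧x≢y⇒x∈p-y; Empty-unique; ∣⊥∣≡0)
open import Data.Vec using ([]; _∷_; tabulate; lookup)
open import Data.Vec.Properties using (lookup∘tabulate; lookup⇒[]=; []=⇒lookup; ≡-dec)
open import Data.List using (List; []; _∷_; length; map)
open import Data.List.Properties using (length-map)
import Data.List.Relation.Unary.Any as Any
open import Data.List.Relation.Unary.Any using (here; there)
import Data.List.Relation.Unary.All as All
open import Data.List.Relation.Unary.All using (All; []; _∷_)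
open import Data.List.Relation.Unary.Unique.Propositional using (Unique; []; _∷_)
import Data.List.Membership.Propositional as LM
open import Data.List.Membership.Propositional.Properties using (∈-map⁻; ∈-map∘filter⁻)
open import Data.Product using (∃; _×_; _,_; proj₁; proj₂)
open import Function using (_∘_)
open import Relation.Nullary using (¬_; does; yes; no; ¬?; contradiction)
open import Relation.Nullary.Decidable using (dec-true; dec-false)
open import Relation.Unary using (Pred; Decidable)
open import Relation.Binary.PropositionalEquality
open import Algebra.Properties.CommutativeMonoid.Sum +-0-commutativeMonoid
  using (sum-syntax; sum-cong-≗; sum-remove; sum-replicate-zero; ∑-distrib-+)
open import Algebra.Properties.Semiring.Sum +-*-semiring using (*-distribˡ-sum)

boolToℕ : Bool → ℕ
boolToℕ false = 0
boolToℕ true  = 1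

∑-const : ∀ k c → ∑[ i < k ] c ≡ k * c
∑-const zero    c = refl
∑-const (suc k) c = cong (c +_) (∑-const k c)

∑-mono-≤ : ∀ {k} {f g : Fin k → ℕ} → (∀ i → f i ≤ g i) → ∑[ i < k ] f i ≤ ∑[ i < k ] g i
∑-mono-≤ {zero}  f≤g = z≤n
∑-mono-≤ {suc k} f≤g = +-mono-≤ (f≤g fzero) (∑-mono-≤ (f≤g ∘ fsuc))

term≤∑ : ∀ {k} (f : Fin k → ℕ) i → f i ≤ ∑[ j < k ] f j
term≤∑ f fzero    = m≤m+n (f fzero) _
term≤∑ f (fsuc i) = ≤-trans (term≤∑ (f ∘ fsuc) i) (m≤n+m _ (f fzero))

∑-indicator : ∀ {k} (c : Fin k) → ∑[ i < k ] boolToℕ (does (c ≟ i)) ≡ 1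
∑-indicator {suc k} c = begin
  ∑[ i < suc k ] boolToℕ (does (c ≟ i))
    ≡⟨ sum-remove {i = c} (λ i → boolToℕ (does (c ≟ i))) ⟩
  boolToℕ (does (c ≟ c)) + ∑[ j < k ] boolToℕ (does (c ≟ punchIn c j))
    ≡⟨ cong₂ _+_ (cong boolToℕ (dec-true (c ≟ c) refl)) (sum-cong-≗ off-c) ⟩
  1 + ∑[ j < k ] 0
    ≡⟨ cong suc (sum-replicate-zero k) ⟩
  1 ∎
  where
    open ≡-Reasoning
    off-c : ∀ j → boolToℕ (does (c ≟ punchIn c j)) ≡ 0
    off-c j = cong boolToℕ (dec-false (c ≟ punchIn c j) (punchInᵢ≢i c j ∘ sym))

∣x∷p∣≡ : ∀ {m} x (p : Subset m) → ∣ x ∷ p ∣ ≡ boolToℕ x + ∣ p ∣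
∣x∷p∣≡ true  p = refl
∣x∷p∣≡ false p = refl

∣p∣≡∑lookup : ∀ {k} (p : Subset k) → ∣ p ∣ ≡ ∑[ i < k ] boolToℕ (lookup p i)
∣p∣≡∑lookup []      = refl
∣p∣≡∑lookup (x ∷ p) = trans (∣x∷p∣≡ x p) (cong (boolToℕ x +_) (∣p∣≡∑lookup p))

∈⇒1≤∣p∣ : ∀ {m} {p : Subset m} {x} → x ∈ p → 1 ≤ ∣ p ∣
∈⇒1≤∣p∣ {x = x} x∈p =
  subst (_≤ _) (∣⁅x⁆∣≡1 x) (p⊆q⇒∣p∣≤∣q∣ λ y∈⁅x⁆ → subst (_∈ _) (sym (x∈⁅y⁆⇒x≡y x y∈⁅x⁆)) x∈p)

∣p∣≡1⇒Nonempty : ∀ {m} {p : Subset m} → ∣ p ∣ ≡ 1 → Nonempty p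
∣p∣≡1⇒Nonempty {m} {p} ∣p∣≡1 with nonempty? p
... | yes p≢∅ = p≢∅
... | no  p≡∅ with () ← trans (sym (∣⊥∣≡0 m)) (trans (cong ∣_∣ (sym (Empty-unique p≡∅))) ∣p∣≡1)

∣p∣≡1⇒≡ : ∀ {m} {p : Subset m} {x y} → ∣ p ∣ ≡ 1 → x ∈ p → y ∈ p → x ≡ y
∣p∣≡1⇒≡ {p = p} {x} {y} ∣p∣≡1 x∈p y∈p with x ≟ y
... | yes x≡y = x≡y
... | no  x≢y = contradiction (subst (∣ p - x ∣ <_) ∣p∣≡1 (x∈p⇒∣p-x∣<∣p∣ x∈p))
                             (≤⇒≯ (∈⇒1≤∣p∣ (x∈p∧x≢y⇒x∈p-y y∈p (x≢y ∘ sym))))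

p∩q≡⊤⇒q≡⊤ : ∀ {m} {p q : Subset m} → p ∩ q ≡ ⊤ → q ≡ ⊤
p∩q≡⊤⇒q≡⊤ {p = p} {q} p∩q≡⊤ =
  ⊆-antisym (λ _ → ∈⊤) (λ {i} _ → proj₂ (x∈p∩q⁻ p q (subst (i ∈_) (sym p∩q≡⊤) ∈⊤)))

∈-tabulate⁺ : ∀ {m} {f : Fin m → Bool} {x} → f x ≡ true → x ∈ tabulate f
∈-tabulate⁺ {f = f} {x} fx≡true = lookup⇒[]= x (tabulate f) (trans (lookup∘tabulate f x) fx≡true)

∈-tabulate⁻ : ∀ {m} {f : Fin m → Bool} {x} → x ∈ tabulate f → f x ≡ true
∈-tabulate⁻ {f = f} {x} x∈ = trans (sym (lookup∘tabulate f x)) ([]=⇒lookup x∈)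

module _ {m p} {P : Pred (Fin m) p} (P? : Decidable P) {x : Fin m} where

  ∈-tabulate-does⁺ : P x → x ∈ tabulate (does ∘ P?)
  ∈-tabulate-does⁺ = ∈-tabulate⁺ ∘ dec-true (P? x)

  ∈-tabulate-does⁻ : x ∈ tabulate (does ∘ P?) → P x
  ∈-tabulate-does⁻ x∈ with P? x | ∈-tabulate⁻ x∈
  ... | yes Px | _ = Px

Unique-map⁺ : ∀ {A B : Set} {f : A → B} {xs : List A} →
  (∀ {x y} → x LM.∈ xs → y LM.∈ xs → f x ≡ f y → x ≡ y) → Unique xs → Unique (map f xs)
Unique-map⁺ {xs = []}     inj []         = []
Unique-map⁺ {xs = x ∷ xs} inj (x∉ ∷ xs!) =
  All.tabulate (λ fy∈ fx≡fy → let y , y∈xs , fy≡ = ∈-map⁻ _ fy∈ in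
    All.lookup x∉ y∈xs (inj (here refl) (there y∈xs) (trans fx≡fy fy≡)))
  ∷ Unique-map⁺ (λ x∈ y∈ → inj (there x∈) (there y∈)) xs!

module _ {n : ℕ} where

  insideTails : List (Subset (suc n)) → List (Subset n)
  insideTails []                  = []
  insideTails ((true  ∷ p) ∷ ps) = p ∷ insideTails ps
  insideTails ((false ∷ p) ∷ ps) = insideTails ps

  outsideTails : List (Subset (suc n)) → List (Subset n)
  outsideTails []                  = []
  outsideTails ((true  ∷ p) ∷ ps) = outsideTails ps
  outsideTails ((false ∷ p) ∷ ps) = p ∷ outsideTails ps

  length-insideTails+outsideTails : ∀ ps → length ps ≡ length (insideTails ps) + length (outsideTails ps)
  length-insideTails+outsideTails []                  = refl
  length-insideTails+outsideTails ((true  ∷ p) ∷ ps) = cong suc (length-insideTails+outsideTails ps)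
  length-insideTails+outsideTails ((false ∷ p) ∷ ps) =
    trans (cong suc (length-insideTails+outsideTails ps)) (sym (+-suc _ _))

  insideTails-≢ : ∀ {p} ps → All (inside ∷ p ≢_) ps → All (p ≢_) (insideTails ps)
  insideTails-≢ []                  []         = []
  insideTails-≢ ((true  ∷ q) ∷ ps) (p≢q ∷ ≢s) = (p≢q ∘ cong (inside ∷_)) ∷ insideTails-≢ ps ≢s
  insideTails-≢ ((false ∷ q) ∷ ps) (_   ∷ ≢s) = insideTails-≢ ps ≢s

  outsideTails-≢ : ∀ {p} ps → All (outside ∷ p ≢_) ps → All (p ≢_) (outsideTails ps)
  outsideTails-≢ []                  []         = []
  outsideTails-≢ ((true  ∷ q) ∷ ps) (_   ∷ ≢s) = outsideTails-≢ ps ≢s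
  outsideTails-≢ ((false ∷ q) ∷ ps) (p≢q ∷ ≢s) = (p≢q ∘ cong (outside ∷_)) ∷ outsideTails-≢ ps ≢s

  insideTails-unique : ∀ ps → Unique ps → Unique (insideTails ps)
  insideTails-unique []                  []          = []
  insideTails-unique ((true  ∷ p) ∷ ps) (≢s ∷ ps!) = insideTails-≢ ps ≢s ∷ insideTails-unique ps ps!
  insideTails-unique ((false ∷ p) ∷ ps) (_  ∷ ps!) = insideTails-unique ps ps!

  outsideTails-unique : ∀ ps → Unique ps → Unique (outsideTails ps)
  outsideTails-unique []                  []          = []
  outsideTails-unique ((true  ∷ p) ∷ ps) (_  ∷ ps!) = outsideTails-unique ps ps!
  outsideTails-unique ((false ∷ p) ∷ ps) (≢s ∷ ps!) = outsideTails-≢ ps ≢s ∷ outsideTails-unique ps ps!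

  insideTails-size : ∀ {m} ps → All (λ q → ∣ q ∣ ≡ m) ps → All (λ p → suc ∣ p ∣ ≡ m) (insideTails ps)
  insideTails-size []                  []          = []
  insideTails-size ((true  ∷ p) ∷ ps) (∣p∣ ∷ ∣ps∣) = ∣p∣ ∷ insideTails-size ps ∣ps∣
  insideTails-size ((false ∷ p) ∷ ps) (_   ∷ ∣ps∣) = insideTails-size ps ∣ps∣

  outsideTails-size : ∀ {m} ps → All (λ q → ∣ q ∣ ≡ m) ps → All (λ p → ∣ p ∣ ≡ m) (outsideTails ps)
  outsideTails-size []                  []          = []
  outsideTails-size ((true  ∷ p) ∷ ps) (_   ∷ ∣ps∣) = outsideTails-size ps ∣ps∣
  outsideTails-size ((false ∷ p) ∷ ps) (∣p∣ ∷ ∣ps∣) = ∣p∣ ∷ outsideTails-size ps ∣ps∣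

unique-of-size⇒length≤C : ∀ n m (ps : List (Subset n)) →
  Unique ps → All (λ p → ∣ p ∣ ≡ m) ps → length ps ≤ n C m
unique-of-size⇒length≤C zero m []            _               _           = z≤n
unique-of-size⇒length≤C zero m ([] ∷ [])     _               (refl ∷ []) = s≤s z≤n
unique-of-size⇒length≤C zero m ([] ∷ [] ∷ _) ((≢[] ∷ _) ∷ _) _           = contradiction refl ≢[]
-- No subset of size 0 contains the first element, so insideTails ps is empty.
unique-of-size⇒length≤C (suc n) zero ps ps! ∣ps∣
  with insideTails ps | insideTails-size ps ∣ps∣ | length-insideTails+outsideTails ps
... | [] | [] | length≡ = ≤-trans (≤-reflexive length≡)
  (unique-of-size⇒length≤C n zero (outsideTails ps) (outsideTails-unique ps ps!) (outsideTails-size ps ∣ps∣))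
unique-of-size⇒length≤C (suc n) (suc m) ps ps! ∣ps∣ = begin
  length ps
    ≡⟨ length-insideTails+outsideTails ps ⟩
  length (insideTails ps) + length (outsideTails ps)
    ≤⟨ +-mono-≤ (unique-of-size⇒length≤C n m (insideTails ps) (insideTails-unique ps ps!)
                   (All.map suc-injective (insideTails-size ps ∣ps∣)))
                (unique-of-size⇒length≤C n (suc m) (outsideTails ps) (outsideTails-unique ps ps!)
                   (outsideTails-size ps ∣ps∣)) ⟩
  n C m + n C suc m
    ≡⟨ nCk+nC[k+1]≡[n+1]C[k+1] n m ⟩
  suc n C suc m ∎
  where open ≤-Reasoning

module _ {n : ℕ} where

  vdeg-∷ : ∀ (G : Subset n) L v → vdeg (G ∷ L) v ≡ boolToℕ (does (v ∈? G)) + vdeg L v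
  vdeg-∷ G L v with v ∈? G
  ... | yes _ = refl
  ... | no _  = refl

  length≤∑vdeg : ∀ {k} (vs : Fin k → Fin n) (L : Hypergraph n) →
    (∀ {G} → G LM.∈ L → ∃ λ i → vs i ∈ G) → length L ≤ ∑[ i < k ] vdeg L (vs i)
  length≤∑vdeg vs []      hits = z≤n
  length≤∑vdeg {k} vs (G ∷ L) hits = begin
    1 + length L
      ≤⟨ +-mono-≤ G-hit (length≤∑vdeg vs L (hits ∘ there)) ⟩
    ∑[ i < k ] boolToℕ (does (vs i ∈? G)) + ∑[ i < k ] vdeg L (vs i)
      ≡⟨ ∑-distrib-+ (λ i → boolToℕ (does (vs i ∈? G))) (λ i → vdeg L (vs i)) ⟨
    ∑[ i < k ] (boolToℕ (does (vs i ∈? G)) + vdeg L (vs i))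
      ≡⟨ sum-cong-≗ (λ i → vdeg-∷ G L (vs i)) ⟨
    ∑[ i < k ] vdeg (G ∷ L) (vs i) ∎
    where
      open ≤-Reasoning
      G-hit : 1 ≤ ∑[ i < k ] boolToℕ (does (vs i ∈? G))
      G-hit with i , vsᵢ∈G ← hits (here refl) =
        ≤-trans (≤-reflexive (cong boolToℕ (sym (dec-true (vs i ∈? G) vsᵢ∈G))))
                (term≤∑ (λ j → boolToℕ (does (vs j ∈? G))) i)

  ∑vdeg-bound : ∀ {s k} (vs : Fin k → Fin n) (L : Hypergraph n) →
    (∀ v → s * vdeg L v < length L) → k + s * ∑[ i < k ] vdeg L (vs i) ≤ k * length L
  ∑vdeg-bound {s} {k} vs L sparse = begin
    k + s * ∑[ i < k ] vdeg L (vs i)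
      ≡⟨ cong₂ _+_ (trans (sym (*-identityʳ k)) (sym (∑-const k 1)))
                   (*-distribˡ-sum s (λ i → vdeg L (vs i))) ⟩
    ∑[ i < k ] 1 + ∑[ i < k ] (s * vdeg L (vs i))
      ≡⟨ ∑-distrib-+ (λ _ → 1) (λ i → s * vdeg L (vs i)) ⟨
    ∑[ i < k ] suc (s * vdeg L (vs i))
      ≤⟨ ∑-mono-≤ (sparse ∘ vs) ⟩
    ∑[ i < k ] length L
      ≡⟨ ∑-const k (length L) ⟩
    k * length L ∎
    where open ≤-Reasoning

  diverse-hitting-set : ∀ {s k} {L : Hypergraph n} → Diverse s L →
    (vs : Fin k → Fin n) → (∀ {G} → G LM.∈ L → ∃ λ i → vs i ∈ G) → s < k
  diverse-hitting-set {L = []} (() , _)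
  diverse-hitting-set {s} {k} {L@(_ ∷ _)} (_ , sparse) vs hits = ≰⇒> λ k≤s →
    -- k ≤ s forces k = 0, but the first edge of L is hit by some vs i.
    ¬Fin0 (subst Fin (n≤0⇒n≡0 (+-cancelʳ-≤ (s * length L) k 0 (k+s|L|≤s|L| k≤s))) (proj₁ (hits (here refl))))
    where
      open ≤-Reasoning
      k+s|L|≤s|L| : k ≤ s → k + s * length L ≤ s * length L
      k+s|L|≤s|L| k≤s = begin
        k + s * length L                  ≤⟨ +-monoʳ-≤ k (*-monoʳ-≤ s (length≤∑vdeg vs L hits)) ⟩
        k + s * ∑[ i < k ] vdeg L (vs i)  ≤⟨ ∑vdeg-bound {s} vs L sparse ⟩
        k * length L                      ≤⟨ *-monoˡ-≤ (length L) k≤s ⟩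
        s * length L                      ∎

  diverse⇒avoiding-edge : ∀ {s k} {L : Hypergraph n} → Diverse s L →
    (vs : Fin k → Fin n) → k ≤ s → ∃ λ G → G LM.∈ L × (∀ i → vs i ∉ G)
  diverse⇒avoiding-edge {L = L} div vs k≤s
    with Any.any? (λ G → ¬? (any? (λ i → vs i ∈? G))) L
  ... | yes found = let G , G∈L , misses = LM.find found in G , G∈L , λ i vsᵢ∈G → misses (i , vsᵢ∈G)
  ... | no none = contradiction k≤s (<⇒≱ (diverse-hitting-set div vs hits))
    where
      hits : ∀ {G} → G LM.∈ L → ∃ λ i → vs i ∈ G
      hits {G} G∈L with any? (λ i → vs i ∈? G)
      ... | yes hit = hit
      ... | no miss = contradiction (LM.lose G∈L miss) none

∣p∣≡∑∣p∩X∣ : ∀ {n k} (col : Fin n → Fin k) (p : Subset n) → ∣ p ∣ ≡ ∑[ i < k ] ∣ p ∩ X col i ∣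
∣p∣≡∑∣p∩X∣ {k = k} col []      = sym (sum-replicate-zero k)
∣p∣≡∑∣p∩X∣ {k = k} col (x ∷ p) = begin
  ∣ x ∷ p ∣
    ≡⟨ ∣x∷p∣≡ x p ⟩
  boolToℕ x + ∣ p ∣
    ≡⟨ cong₂ _+_ (sym (∑-head x)) (∣p∣≡∑∣p∩X∣ (col ∘ fsuc) p) ⟩
  ∑[ i < k ] boolToℕ (x ∧ does (col fzero ≟ i)) + ∑[ i < k ] ∣ p ∩ X (col ∘ fsuc) i ∣
    ≡⟨ ∑-distrib-+ (λ i → boolToℕ (x ∧ does (col fzero ≟ i))) (λ i → ∣ p ∩ X (col ∘ fsuc) i ∣) ⟨
  ∑[ i < k ] (boolToℕ (x ∧ does (col fzero ≟ i)) + ∣ p ∩ X (col ∘ fsuc) i ∣)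
    ≡⟨ sum-cong-≗ (λ i → ∣x∷p∣≡ (x ∧ does (col fzero ≟ i)) (p ∩ X (col ∘ fsuc) i)) ⟨
  ∑[ i < k ] ∣ (x ∷ p) ∩ X col i ∣ ∎
  where
    open ≡-Reasoning
    ∑-head : ∀ x → ∑[ i < k ] boolToℕ (x ∧ does (col fzero ≟ i)) ≡ boolToℕ x
    ∑-head true  = ∑-indicator (col fzero)
    ∑-head false = sum-replicate-zero k

module _ {n k : ℕ} (col : Fin n → Fin k) where

  ∈X⁺ : ∀ {v i} → col v ≡ i → v ∈ X col i
  ∈X⁺ {i = i} = ∈-tabulate-does⁺ (λ w → col w ≟ i)

  ∈X⁻ : ∀ {v i} → v ∈ X col i → col v ≡ i
  ∈X⁻ {i = i} = ∈-tabulate-does⁻ (λ w → col w ≟ i)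

  ∈restrict⁺ : ∀ {F J v} → v ∈ F → col v ∈ J → v ∈ restrict col F J
  ∈restrict⁺ v∈F colv∈J = x∈p∩q⁺ (v∈F , ∈-tabulate⁺ ([]=⇒lookup colv∈J))

  ∈restrict⁻ : ∀ {F J v} → v ∈ restrict col F J → v ∈ F × col v ∈ J
  ∈restrict⁻ {F} {J} {v} v∈F_J =
    let v∈F , v∈X_J = x∈p∩q⁻ F (XJ col J) v∈F_J
    in v∈F , lookup⇒[]= (col v) J (∈-tabulate⁻ v∈X_J)

  ∈pattern⁺ : ∀ {D v} → v ∈ D → col v ∈ pattern' col D
  ∈pattern⁺ {D} v∈D = ∈-tabulate-does⁺ (λ i → nonempty? (D ∩ X col i)) (_ , x∈p∩q⁺ (v∈D , ∈X⁺ refl))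

  ∈pattern⁻ : ∀ {D i} → i ∈ pattern' col D → ∃ λ v → v ∈ D × col v ≡ i
  ∈pattern⁻ {D} i∈π with v , v∈D∩Xᵢ ← ∈-tabulate-does⁻ (λ i → nonempty? (D ∩ X col i)) i∈π =
    let v∈D , v∈Xᵢ = x∈p∩q⁻ D _ v∈D∩Xᵢ in v , v∈D , ∈X⁻ v∈Xᵢ

  ∩-restrict-chain : ∀ {F E E′ J J′} → restrict col F J ⊆ E → F ∩ E ⊆ restrict col F J →
    restrict col E J′ ⊆ E′ → F ∩ E′ ⊆ restrict col E J′ → F ∩ E′ ≡ restrict col F (J ∩ J′)
  ∩-restrict-chain {F} {E} {E′} {J} {J′} F_J⊆E F∩E⊆F_J E_J′⊆E′ F∩E′⊆E_J′ = ⊆-antisym meet⊆ ⊆meet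
    where
      meet⊆ : F ∩ E′ ⊆ restrict col F (J ∩ J′)
      meet⊆ v∈F∩E′ =
        let v∈F , _ = x∈p∩q⁻ F E′ v∈F∩E′
            v∈E , colv∈J′ = ∈restrict⁻ {E} {J′} (F∩E′⊆E_J′ v∈F∩E′)
            _ , colv∈J = ∈restrict⁻ {F} {J} (F∩E⊆F_J (x∈p∩q⁺ (v∈F , v∈E)))
        in ∈restrict⁺ v∈F (x∈p∩q⁺ (colv∈J , colv∈J′))
      ⊆meet : restrict col F (J ∩ J′) ⊆ F ∩ E′
      ⊆meet v∈F_J∩J′ =
        let v∈F , colv∈J∩J′ = ∈restrict⁻ {F} {J ∩ J′} v∈F_J∩J′
            colv∈J , colv∈J′ = x∈p∩q⁻ J J′ colv∈J∩J′
            v∈E = F_J⊆E (∈restrict⁺ v∈F colv∈J)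
        in x∈p∩q⁺ (v∈F , E_J′⊆E′ (∈restrict⁺ v∈E colv∈J′))

module KPartite {n k : ℕ} (col : Fin n → Fin k) (ℱ : Hypergraph n) (kp : IsKPartite col ℱ) where

  one-per-colour : ∀ {F} → F LM.∈ ℱ → ∀ i → ∣ F ∩ X col i ∣ ≡ 1
  one-per-colour {F} = proj₂ kp F

  colour-class-nonempty : ∀ {F} → F LM.∈ ℱ → ∀ i → Nonempty (F ∩ X col i)
  colour-class-nonempty {F} F∈ℱ i = ∣p∣≡1⇒Nonempty {p = F ∩ X col i} (one-per-colour F∈ℱ i)

  vertex : ∀ {F} → F LM.∈ ℱ → Fin k → Fin n
  vertex F∈ℱ i = proj₁ (colour-class-nonempty F∈ℱ i)

  vertex∈ : ∀ {F} (F∈ℱ : F LM.∈ ℱ) i → vertex F∈ℱ i ∈ F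
  vertex∈ F∈ℱ i = proj₁ (x∈p∩q⁻ _ _ (proj₂ (colour-class-nonempty F∈ℱ i)))

  col-vertex : ∀ {F} (F∈ℱ : F LM.∈ ℱ) i → col (vertex F∈ℱ i) ≡ i
  col-vertex F∈ℱ i = ∈X⁻ col (proj₂ (x∈p∩q⁻ _ _ (proj₂ (colour-class-nonempty F∈ℱ i))))

  colour-injective : ∀ {F v w} → F LM.∈ ℱ → v ∈ F → w ∈ F → col v ≡ col w → v ≡ w
  colour-injective {F} {v} F∈ℱ v∈F w∈F colv≡colw =
    ∣p∣≡1⇒≡ {p = F ∩ X col (col v)} (one-per-colour F∈ℱ (col v))
      (x∈p∩q⁺ (v∈F , ∈X⁺ col refl)) (x∈p∩q⁺ (w∈F , ∈X⁺ col (sym colv≡colw)))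

  vertex-col : ∀ {F v} (F∈ℱ : F LM.∈ ℱ) → v ∈ F → vertex F∈ℱ (col v) ≡ v
  vertex-col {v = v} F∈ℱ v∈F = colour-injective F∈ℱ (vertex∈ F∈ℱ (col v)) v∈F (col-vertex F∈ℱ (col v))

  colours⊆⇒⊤ : ∀ {F K} → F LM.∈ ℱ → (∀ {v} → v ∈ F → col v ∈ K) → K ≡ ⊤
  colours⊆⇒⊤ {K = K} F∈ℱ col∈K =
    ⊆-antisym (λ _ → ∈⊤) (λ {i} _ → subst (_∈ K) (col-vertex F∈ℱ i) (col∈K (vertex∈ F∈ℱ i)))

  pattern-restrict : ∀ {F J} → F LM.∈ ℱ → pattern' col (restrict col F J) ≡ J
  pattern-restrict {F} {J} F∈ℱ = ⊆-antisym π⊆J J⊆π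
    where
      π⊆J : pattern' col (restrict col F J) ⊆ J
      π⊆J i∈π with v , v∈F_J , colv≡i ← ∈pattern⁻ col i∈π =
        subst (_∈ J) colv≡i (proj₂ (∈restrict⁻ col {F} {J} v∈F_J))
      J⊆π : J ⊆ pattern' col (restrict col F J)
      J⊆π {i} i∈J = subst (_∈ pattern' col (restrict col F J)) (col-vertex F∈ℱ i)
        (∈pattern⁺ col (∈restrict⁺ col (vertex∈ F∈ℱ i) (subst (_∈ J) (sym (col-vertex F∈ℱ i)) i∈J)))

  pattern≡⊤⇒⊆ : ∀ {E F} → E LM.∈ ℱ → pattern' col (E ∩ F) ≡ ⊤ → E ⊆ F
  pattern≡⊤⇒⊆ {E} {F} E∈ℱ π≡⊤ {v} v∈E
    with w , w∈E∩F , colw≡colv ← ∈pattern⁻ col (subst (col v ∈_) (sym π≡⊤) ∈⊤) =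
    let w∈E , w∈F = x∈p∩q⁻ E F w∈E∩F in subst (_∈ F) (colour-injective E∈ℱ w∈E v∈E colw≡colv) w∈F

  ⊤∉MI : ¬ InMI col ℱ ⊤
  ⊤∉MI (E , F , E∈ℱ , F∈ℱ , E≢F , π≡⊤) =
    E≢F (⊆-antisym (pattern≡⊤⇒⊆ E∈ℱ π≡⊤) (pattern≡⊤⇒⊆ F∈ℱ (trans (cong (pattern' col) (∩-comm F E)) π≡⊤)))

  ∣restrict∣≡ : ∀ {F} → F LM.∈ ℱ → ∀ D → ∣ restrict col F D ∣ ≡ ∣ D ∣
  ∣restrict∣≡ {F} F∈ℱ D = begin
    ∣ restrict col F D ∣                              ≡⟨ ∣p∣≡∑∣p∩X∣ col (restrict col F D) ⟩
    ∑[ i < k ] ∣ restrict col F D ∩ X col i ∣        ≡⟨ sum-cong-≗ per-colour ⟩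
    ∑[ i < k ] boolToℕ (lookup D i)                  ≡⟨ ∣p∣≡∑lookup D ⟨
    ∣ D ∣                                              ∎
    where
      open ≡-Reasoning
      per-colour : ∀ i → ∣ restrict col F D ∩ X col i ∣ ≡ boolToℕ (lookup D i)
      per-colour i with lookup D i in D[i]
      ... | true  = trans (cong ∣_∣ (⊆-antisym ⊆F∩Xᵢ F∩Xᵢ⊆)) (one-per-colour F∈ℱ i)
        where
          ⊆F∩Xᵢ : restrict col F D ∩ X col i ⊆ F ∩ X col i
          ⊆F∩Xᵢ v∈ = let v∈F_D , v∈Xᵢ = x∈p∩q⁻ _ _ v∈ in
            x∈p∩q⁺ (proj₁ (∈restrict⁻ col {F} {D} v∈F_D) , v∈Xᵢ)
          F∩Xᵢ⊆ : F ∩ X col i ⊆ restrict col F D ∩ X col i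
          F∩Xᵢ⊆ v∈ = let v∈F , v∈Xᵢ = x∈p∩q⁻ _ _ v∈ in
            x∈p∩q⁺ (∈restrict⁺ col v∈F (subst (_∈ D) (sym (∈X⁻ col v∈Xᵢ)) (lookup⇒[]= i D D[i])) , v∈Xᵢ)
      ... | false = trans (cong ∣_∣ (Empty-unique nothing-of-colour-i)) (∣⊥∣≡0 n)
        where
          nothing-of-colour-i : Empty (restrict col F D ∩ X col i)
          nothing-of-colour-i (v , v∈) with v∈F_D , v∈Xᵢ ← x∈p∩q⁻ _ _ v∈
            with () ← trans (sym D[i])
                        ([]=⇒lookup (subst (_∈ D) (∈X⁻ col v∈Xᵢ) (proj₂ (∈restrict⁻ col {F} {D} v∈F_D))))

  misses⇒∩⊆ : ∀ {F E D} (F∈ℱ : F LM.∈ ℱ) → (∀ i → vertex F∈ℱ i ∉ E ─ D) → F ∩ E ⊆ D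
  misses⇒∩⊆ {F} {E} {D} F∈ℱ misses {v} v∈F∩E with v ∈? D
  ... | yes v∈D = v∈D
  ... | no  v∉D = let v∈F , v∈E = x∈p∩q⁻ F E v∈F∩E in
    contradiction (subst (_∈ E ─ D) (sym (vertex-col F∈ℱ v∈F)) (x∈p∧x∉q⇒x∈p─q v∈E v∉D)) (misses (col v))

  meet≡restrict⇒InMI : ∀ {J F E} → J ≢ ⊤ → F LM.∈ ℱ → E LM.∈ ℱ → F ∩ E ≡ restrict col F J → InMI col ℱ J
  meet≡restrict⇒InMI {J} {F} {E} J≢⊤ F∈ℱ E∈ℱ F∩E≡F_J with ≡-dec Bool._≟_ F E
  ... | yes refl = contradiction (colours⊆⇒⊤ F∈ℱ λ v∈F →
                     proj₂ (∈restrict⁻ col {F} {J} (subst (_ ∈_) F∩E≡F_J (x∈p∩q⁺ (v∈F , v∈F))))) J≢⊤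
  ... | no  F≢E  = F , E , F∈ℱ , E∈ℱ , F≢E , trans (cong (pattern' col) F∩E≡F_J) (pattern-restrict F∈ℱ)

  restrict-injective : ∀ {D} → NotCovered col ℱ D →
    ∀ {E F} → E LM.∈ ℱ → F LM.∈ ℱ → restrict col E D ≡ restrict col F D → E ≡ F
  restrict-injective {D} D-uncovered {E} {F} E∈ℱ F∈ℱ E_D≡F_D with ≡-dec Bool._≟_ E F
  ... | yes E≡F = E≡F
  ... | no  E≢F = contradiction (λ {i} → D⊆π {i}) (D-uncovered _ (E , F , E∈ℱ , F∈ℱ , E≢F , refl))
    where
      D⊆π : D ⊆ pattern' col (E ∩ F)
      D⊆π {i} i∈D =
        let v∈E = vertex∈ E∈ℱ i
            v∈E_D = ∈restrict⁺ col v∈E (subst (_∈ D) (sym (col-vertex E∈ℱ i)) i∈D)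
            v∈F , _ = ∈restrict⁻ col {F} {D} (subst (vertex E∈ℱ i ∈_) E_D≡F_D v∈E_D)
        in subst (_∈ pattern' col (E ∩ F)) (col-vertex E∈ℱ i) (∈pattern⁺ col (x∈p∩q⁺ (v∈E , v∈F)))

  length≤C∣uncovered∣ : ∀ {D} → NotCovered col ℱ D → length ℱ ≤ n C ∣ D ∣
  length≤C∣uncovered∣ {D} D-uncovered = begin
    length ℱ                 ≡⟨ length-map restrictD ℱ ⟨
    length (map restrictD ℱ) ≤⟨ unique-of-size⇒length≤C n ∣ D ∣ (map restrictD ℱ)
                                  restrictions-unique (All.tabulate sizes) ⟩
    n C ∣ D ∣                  ∎
    where
      open ≤-Reasoning
      restrictD : Subset n → Subset n
      restrictD F = restrict col F D
      restrictions-unique : Unique (map restrictD ℱ)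
      restrictions-unique = Unique-map⁺ (restrict-injective D-uncovered) (proj₁ kp)
      sizes : ∀ {p} → p LM.∈ map restrictD ℱ → ∣ p ∣ ≡ ∣ D ∣
      sizes p∈ with F , F∈ℱ , refl ← ∈-map⁻ restrictD p∈ = ∣restrict∣≡ F∈ℱ D

  module _ {s} (SH : SuperHomogeneous s col ℱ) (k≤s : k ≤ s) where

    extend : ∀ {J E F} → InMI col ℱ J → E LM.∈ ℱ → F LM.∈ ℱ →
      ∃ λ E′ → E′ LM.∈ ℱ × restrict col E J ⊆ E′ × F ∩ E′ ⊆ restrict col E J
    extend {J} {E} {F} J∈MI E∈ℱ F∈ℱ
      with G , G∈link , G-misses-F ← diverse⇒avoiding-edge (proj₁ (SH J J∈MI E E∈ℱ)) (vertex F∈ℱ) k≤s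
      with E′ , E′∈ℱ , G≡E′─E_J , E_J⊆E′ ← ∈-map∘filter⁻ (_─ restrict col E J) (restrict col E J ⊆?_) G∈link
      = E′ , E′∈ℱ , E_J⊆E′ , misses⇒∩⊆ F∈ℱ (λ i → G-misses-F i ∘ subst (_ ∈_) (sym G≡E′─E_J))

    MI-∩-closed : ∀ J J′ → InMI col ℱ J → InMI col ℱ J′ → InMI col ℱ (J ∩ J′)
    MI-∩-closed J J′ J∈MI@(F , _ , F∈ℱ , _) J′∈MI
      with E  , E∈ℱ  , F_J⊆E   , F∩E⊆F_J   ← extend J∈MI F∈ℱ F∈ℱ
      with E′ , E′∈ℱ , E_J′⊆E′ , F∩E′⊆E_J′ ← extend J′∈MI E∈ℱ F∈ℱ
      = meet≡restrict⇒InMI (λ J∩J′≡⊤ → ⊤∉MI (subst (InMI col ℱ) (p∩q≡⊤⇒q≡⊤ J∩J′≡⊤) J′∈MI)) F∈ℱ E′∈ℱ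
          (∩-restrict-chain col {J = J} {J′} F_J⊆E F∩E⊆F_J E_J′⊆E′ F∩E′⊆E_J′)

lemma3p3 : (s k n : ℕ) → 2 ≤ s → 2 ≤ k → 2 * k ≤ s →
    (col : Fin n → Fin k) → (ℱ : Hypergraph n) →
    IsKPartite col ℱ → SuperHomogeneous s col ℱ →
      ((J : Subset k) → J ≢ ⊤ → ¬ InMI col ℱ J → ∀ F → F LM.∈ ℱ →
         ¬ (∃ λ F′ → F′ LM.∈ ℱ × F ∩ F′ ≡ restrict col F J))
      × ((J J′ : Subset k) → InMI col ℱ J → InMI col ℱ J′ → InMI col ℱ (J ∩ J′))
      × ((m : ℕ) → RankMI col ℱ m → length ℱ ≤ n C m)
lemma3p3 s k n _ _ 2k≤s col ℱ kp SH =
    (λ J J≢⊤ J∉MI F F∈ℱ (F′ , F′∈ℱ , F∩F′≡F_J) → J∉MI (meet≡restrict⇒InMI J≢⊤ F∈ℱ F′∈ℱ F∩F′≡F_J))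
  , MI-∩-closed SH (≤-trans (m≤m+n k (k + 0)) 2k≤s)
  , λ { m ((D , D-uncovered , refl) , _) → length≤C∣uncovered∣ D-uncovered }
  where open KPartite col ℱ kp
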